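{- Let $x,y$ be positive real numbers and let $m\leq n\leq x$ be positive integers such that every prime factor of $mn$ is greater than $y$ (i.e. $P^{ - }(mn)>y$). Then either $m\mid n$ or $\gcd(m,n)<x/y$.
   Context: $P^{ - }(k)$ denotes the smallest prime factor of the integer $k$.
   Formalization: The parameters x and y range over the positive rationals instead of the positive reals. -}

module Defs where

open import Data.Nat using (ℕ)
open import Data.Integer using (+_)
open import Data.Rational using (ℚ; _/_)

ℕ→ℚ : ℕ → ℚ
ℕ→ℚ n = (+ n) / 1

{-# OPTIONS --safe #-}
module Submission where

-- If m ∤ n, the cofactor m / gcd(m, n) exceeds 1, so it has a prime factor p; p divides mn, hence
-- y < p, and gcd(m, n) · y < gcd(m, n) · p ≤ m ≤ n ≤ x.

open import Defs
open import Data.Nat using (ℕ; _≤_; _*_)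
open import Data.Nat.Divisibility using (_∣_)
open import Data.Nat.GCD using (gcd)
open import Data.Nat.Primality using (Prime)
open import Data.Sum using (_⊎_)
open import Data.Rational using (ℚ; 0ℚ; _÷_; positive) renaming (_<_ to _<ℚ_; _≤_ to _≤ℚ_)
open import Data.Rational.Properties using (pos⇒nonZero)

open import Data.Nat.Base using (suc; _<_; NonZero; >-nonZero; ≢-nonZero; ≢-nonZero⁻¹; s<s; z<s)
open import Data.Nat.Properties using (>⇒≢; *-identityˡ; *-comm; ≤-trans)
open import Data.Nat.Divisibility using (_∤_; _∣?_; divides; ∣-trans; ∣⇒≤; m∣m*n; *-monoˡ-∣)
open import Data.Nat.GCD using (gcd[m,n]∣m; gcd[m,n]∣n; gcd[m,n]≢0)
open import Data.Nat.Coprimality using (1-coprimeTo) renaming (sym to coprime-sym)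
open import Data.Nat.Primality.Factorisation using (factorise)
open import Data.Integer using (+_; +≤+) renaming (_≤_ to _≤ℤ_)
open import Data.Integer.Properties using (pos-*; *-identityʳ)
open import Data.Rational using (mkℚ; 1ℚ; Positive; _/_; *≤*; 1/_) renaming (_*_ to _*ℚ_; NonZero to NonZeroℚ)
open import Data.Rational.Properties using (↥p/↧p≡p; *-monoʳ-<-pos; *-cancelʳ-<-nonNeg; pos⇒nonNeg; *-inverseˡ; module ≤-Reasoning)
  renaming (*-assoc to *ℚ-assoc; *-identityʳ to *ℚ-identityʳ)
open import Data.List using ([]; _∷_)
open import Data.Nat.ListAction using (product)
open import Data.List.Relation.Unary.All using (_∷_)
open import Data.Product using (_×_; _,_; ∃-syntax)
open import Data.Sum using (inj₁; inj₂)
open import Relation.Nullary using (yes; no; contradiction)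
open import Relation.Binary.PropositionalEquality using (_≡_; sym; trans; cong; subst; subst₂; module ≡-Reasoning)

1<⇒∃prime∣ : ∀ {k} → 1 < k → ∃[ p ] Prime p × p ∣ k
1<⇒∃prime∣ {suc k} 1<k with factorise (suc k)
... | record { factors = [] ; isFactorisation = k≡1 } = contradiction k≡1 (>⇒≢ 1<k)
... | record { factors = p ∷ ps ; isFactorisation = k≡∏ ; factorsPrime = prime-p ∷ _ } =
  p , prime-p , subst (p ∣_) (sym k≡∏) (m∣m*n (product ps))

∤⇒∃prime[*gcd]∣ : ∀ {m n} .{{_ : NonZero m}} → m ∤ n → ∃[ p ] Prime p × p * gcd m n ∣ m
∤⇒∃prime[*gcd]∣ {m} {n} m∤n with gcd[m,n]∣m m n
... | divides 0 m≡0 = contradiction m≡0 (≢-nonZero⁻¹ m)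
... | divides 1 m≡1*g =
  contradiction (subst (_∣ n) (sym (trans m≡1*g (*-identityˡ _))) (gcd[m,n]∣n m n)) m∤n
... | divides k@(suc (suc _)) m≡k*g with 1<⇒∃prime∣ {k} (s<s z<s)
...   | p , prime-p , p∣k = p , prime-p , subst (p * gcd m n ∣_) (sym m≡k*g) (*-monoˡ-∣ (gcd m n) p∣k)

ℕ→ℚ≡mkℚ : ∀ n → ℕ→ℚ n ≡ mkℚ (+ n) 0 (coprime-sym (1-coprimeTo n))
ℕ→ℚ≡mkℚ n = ↥p/↧p≡p (mkℚ (+ n) 0 (coprime-sym (1-coprimeTo n)))

ℕ→ℚ-homo-* : ∀ a b → ℕ→ℚ (a * b) ≡ ℕ→ℚ a *ℚ ℕ→ℚ b
ℕ→ℚ-homo-* a b rewrite ℕ→ℚ≡mkℚ a | ℕ→ℚ≡mkℚ b = cong (_/ 1) (pos-* a b)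

ℕ→ℚ-mono-≤ : ∀ {a b} → a ≤ b → ℕ→ℚ a ≤ℚ ℕ→ℚ b
ℕ→ℚ-mono-≤ {a} {b} a≤b rewrite ℕ→ℚ≡mkℚ a | ℕ→ℚ≡mkℚ b =
  *≤* (subst₂ _≤ℤ_ (sym (*-identityʳ (+ a))) (sym (*-identityʳ (+ b))) (+≤+ a≤b))

ℕ→ℚ-pos : ∀ n .{{_ : NonZero n}} → Positive (ℕ→ℚ n)
ℕ→ℚ-pos n@(suc _) rewrite ℕ→ℚ≡mkℚ n = _

÷-*-cancel : ∀ p q .{{_ : NonZeroℚ q}} → (p ÷ q) *ℚ q ≡ p
÷-*-cancel p q = begin
  p *ℚ 1/ q *ℚ q    ≡⟨ *ℚ-assoc p (1/ q) q ⟩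
  p *ℚ (1/ q *ℚ q)  ≡⟨ cong (p *ℚ_) (*-inverseˡ q) ⟩
  p *ℚ 1ℚ           ≡⟨ *ℚ-identityʳ p ⟩
  p                 ∎
  where open ≡-Reasoning

*<⇒<÷ : ∀ {p q} r .{{_ : Positive r}} → p *ℚ r <ℚ q → p <ℚ (q ÷ r) {{pos⇒nonZero r}}
*<⇒<÷ {p} {q} r pr<q = *-cancelʳ-<-nonNeg r {{pos⇒nonNeg r}} (subst (p *ℚ r <ℚ_) q≡q÷r*r pr<q)
  where
  q≡q÷r*r : q ≡ (q ÷ r) {{pos⇒nonZero r}} *ℚ r
  q≡q÷r*r = sym (÷-*-cancel q r {{pos⇒nonZero r}})

lemma2 : (x y : ℚ) → (x>0 : 0ℚ <ℚ x) → (y>0 : 0ℚ <ℚ y) → (m n : ℕ) → 1 ≤ m → m ≤ n → ℕ→ℚ n ≤ℚ x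
    → (∀ p → Prime p → p ∣ m * n → y <ℚ ℕ→ℚ p)
    → m ∣ n ⊎ ℕ→ℚ (gcd m n) <ℚ (x ÷ y) {{pos⇒nonZero y {{positive y>0}}}}
lemma2 x y _ y>0 m n 1≤m m≤n n≤x rough with m ∣? n
... | yes m∣n = inj₁ m∣n
... | no m∤n with ∤⇒∃prime[*gcd]∣ {{>-nonZero 1≤m}} m∤n
...   | p , prime-p , p*g∣m = inj₂ (*<⇒<÷ y (begin-strict
    ℕ→ℚ g *ℚ y      <⟨ *-monoʳ-<-pos (ℕ→ℚ g) {{ℕ→ℚ-pos g}} y<p ⟩
    ℕ→ℚ g *ℚ ℕ→ℚ p  ≡⟨ sym (ℕ→ℚ-homo-* g p) ⟩
    ℕ→ℚ (g * p)     ≡⟨ cong ℕ→ℚ (*-comm g p) ⟩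
    ℕ→ℚ (p * g)     ≤⟨ ℕ→ℚ-mono-≤ (≤-trans (∣⇒≤ p*g∣m) m≤n) ⟩
    ℕ→ℚ n           ≤⟨ n≤x ⟩
    x               ∎))
  where
  open ≤-Reasoning
  g = gcd m n
  instance
    _ = >-nonZero 1≤m
    _ = positive y>0
    g≢0 : NonZero g
    g≢0 = ≢-nonZero (gcd[m,n]≢0 m n (inj₁ (≢-nonZero⁻¹ m)))
  y<p : y <ℚ ℕ→ℚ p
  y<p = rough p prime-p (∣-trans (∣-trans (m∣m*n g) p*g∣m) (m∣m*n n))
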